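{- Let $\Gamma$ be a graph and $v_0$ a vertex of $\Gamma$. Let $g\colon\mathbf P\to\mathbf{QD}_{v_0}(\Gamma)$ be an injective morphism of ranked posets. Then there are parallel edges $e_1,e_2\in E(\Gamma)$, with end-vertices $s,t$, and a divisor $D$ on $\Gamma$ such that $g(\mathbf P)=\{(\{e_1\},D+v_{e_1}),(\{e_2\},D+v_{e_2}),(\emptyset,D+s),(\emptyset,D+t)\}$.
   Context: Graphs are finite, loops and multiple edges allowed, with weights $w\colon V(\Gamma)\to\mathbb Z_{\ge0}$ and genus $g_\Gamma=b_1(\Gamma)+\sum w(v)$; $\mathrm{val}(v)$ counts loops twice. Two edges are parallel if there are two vertices each incident to both. For $\mathcal E\subset E(\Gamma)$, $\Gamma^{\mathcal E}$ is obtained by inserting one vertex $v_e$ in the interior of each $e\in\mathcal E$. A pseudo-divisor is $(\mathcal E,D)$ with $D\colon V(\Gamma^{\mathcal E})\to\mathbb Z$, $D(v_e)=1$ for $e\in\mathcal E$; $D+v_e$ denotes extension by value $1$ at $v_e$, $D+s$ adds $1$ at vertex $s$. Order: $(\mathcal E,D)\ge(\mathcal E',D')$ iff $\mathcal E'\subset\mathcal E$ and there is $\varphi\colon\mathcal E\setminus\mathcal E'\to V(\Gamma)$, $\varphi(e)$ an end-vertex of $e$, with $D'(v)=D(v)+|\varphi^{ -1}(v)|$ for $v\in V(\Gamma)$. Canonical polarization $\mu(v)=w(v)-1+\mathrm{val}(v)/2$ on $V(\Gamma)$, $0$ on exceptional vertices; $(\mathcal E,D)$ of degree $g_\Gamma-1$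 is $v_0$-quasistable if $D(V)-\mu(V)+\delta_V/2\ge0$ for all nonempty $V\subset V(\Gamma^{\mathcal E})$, strictly when $v_0\notin V$ ($\delta_V$ = number of edges of $\Gamma^{\mathcal E}$ between $V$ and its complement). $\mathbf{QD}_{v_0}(\Gamma)$ is the poset of these, ranked by $\mathrm{rk}(\mathcal E,D)=|\mathcal E|$. $\mathbf P=\{\alpha,\beta,\gamma,\delta\}$ is the ranked poset with only strict relations $\alpha,\beta>\gamma,\delta$; $\alpha,\beta$ have rank 1 and $\gamma,\delta$ rank 0. A morphism of ranked posets is an order-preserving map preserving rank. -}

module Defs where

open import Data.Nat as ℕ using (ℕ; zero; suc)
open import Data.Integer as ℤ using (ℤ; +_; _+_; _-_; _*_; _≤_; _<_)
open import Data.Bool using (Bool; true; false; _∧_; _∨_; not; _xor_; if_then_else_)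
open import Data.Fin using (Fin; zero; suc; _≟_; _<?_)
open import Data.Fin.Subset using (Subset; _∈_; _∉_; _⊆_; ⁅_⁆; ∣_∣)
import Data.Fin.Subset as Sub
open import Data.Vec using (Vec; lookup; _[_]%=_)
open import Data.Product using (Σ; ∃; _×_; _,_; proj₁; proj₂)
open import Data.Sum using (_⊎_)
open import Relation.Nullary using (¬_)
open import Relation.Nullary.Decidable using (⌊_⌋)
open import Relation.Binary.PropositionalEquality using (_≡_; _≢_)

-- Graphs: vertices Fin n, edges Fin m, each edge has two end-vertices
-- (src e = tgt e for a loop); multiple edges and loops allowed;
-- weights w : Fin n → ℕ.

record Graph : Set where
  field
    n   : ℕ
    m   : ℕ
    src : Fin m → Fin n
    tgt : Fin m → Fin n
    w   : Fin n → ℕ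
open Graph public

∑ : ∀ {k} → (Fin k → ℤ) → ℤ
∑ {zero}  f = + 0
∑ {suc k} f = f zero + ∑ (λ i → f (suc i))

anyF : ∀ {k} → (Fin k → Bool) → Bool
anyF {zero}  f = false
anyF {suc k} f = f zero ∨ anyF (λ i → f (suc i))

[_] : Bool → ℤ
[ b ] = if b then + 1 else + 0

module _ (Γ : Graph) where

  _==_ : Fin (n Γ) → Fin (n Γ) → Bool
  u == v = ⌊ u ≟ v ⌋

  -- valence; a loop counts twice
  val : Fin (n Γ) → ℤ
  val v = ∑ (λ e → [ src Γ e == v ] + [ tgt Γ e == v ])

  -- 2μ(v) = 2w(v) - 2 + val(v)   (canonical polarization, doubled)
  twoμ : Fin (n Γ) → ℤ
  twoμ v = + 2 * + w Γ v - + 2 + val v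

  adj : Fin (n Γ) → Fin (n Γ) → Bool
  adj u v = anyF (λ e → ((src Γ e == u) ∧ (tgt Γ e == v)) ∨ ((src Γ e == v) ∧ (tgt Γ e == u)))

  reachK : ℕ → Fin (n Γ) → Fin (n Γ) → Bool
  reachK zero    u v = u == v
  reachK (suc k) u v = reachK k u v ∨ anyF (λ x → reachK k u x ∧ adj x v)

  connected-to : Fin (n Γ) → Fin (n Γ) → Bool
  connected-to = reachK (n Γ)

  -- number of connected components = number of vertices that are the
  -- smallest vertex of their component
  components : ℤ
  components = ∑ (λ v → [ not (anyF (λ u → ⌊ u <? v ⌋ ∧ connected-to u v)) ])

  b₁ : ℤ
  b₁ = + m Γ - + n Γ + components

  genus : ℤ
  genus = b₁ + ∑ (λ v → + w Γ v)

  -- Pseudo-divisors (ℰ , D): ℰ ⊆ E(Γ) and D recorded on the original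
  -- vertices V(Γ) only; its value on each exceptional vertex v_e (e ∈ ℰ)
  -- is 1 by definition.
  PseudoDiv : Set
  PseudoDiv = Subset (m Γ) × Vec ℤ (n Γ)

  -- a subset V of V(Γ^ℰ) is encoded by (S , T): S ⊆ V(Γ) and the
  -- exceptional vertices v_e with e ∈ ℰ ∩ T
  module _ (ℰ : Subset (m Γ)) (S : Subset (n Γ)) (T : Subset (m Γ)) where

    inT : Fin (m Γ) → Bool
    inT e = lookup ℰ e ∧ lookup T e

    NonemptyV : Set
    NonemptyV = (∃ λ v → v ∈ S) ⊎ (∃ λ e → inT e ≡ true)

    twoμV : ℤ
    twoμV = ∑ (λ v → [ lookup S v ] * twoμ v)

    -- δ_V : edges of Γ^ℰ between V and its complement
    δV : ℤ
    δV = ∑ (λ e → if lookup ℰ e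
                   then [ lookup S (src Γ e) xor inT e ] + [ inT e xor lookup S (tgt Γ e) ]
                   else [ lookup S (src Γ e) xor lookup S (tgt Γ e) ])

  DV : PseudoDiv → Subset (n Γ) → Subset (m Γ) → ℤ
  DV (ℰ , D) S T = ∑ (λ v → [ lookup S v ] * lookup D v) + ∑ (λ e → [ inT ℰ S T e ])

  degree : PseudoDiv → ℤ
  degree (ℰ , D) = ∑ (λ v → lookup D v) + ∑ (λ e → [ lookup ℰ e ])

  -- doubled quasistability quantity  2(D(V) - μ(V) + δ_V/2)
  qs : PseudoDiv → Subset (n Γ) → Subset (m Γ) → ℤ
  qs (ℰ , D) S T = + 2 * DV (ℰ , D) S T - twoμV ℰ S T + δV ℰ S T

  QuasiStable : Fin (n Γ) → PseudoDiv → Set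
  QuasiStable v₀ (ℰ , D) =
    degree (ℰ , D) ≡ genus - + 1 ×
    (∀ S T → NonemptyV ℰ S T →
       (+ 0 ≤ qs (ℰ , D) S T) × (v₀ ∉ S → + 0 < qs (ℰ , D) S T))

  _≥PD_ : PseudoDiv → PseudoDiv → Set
  (ℰ , D) ≥PD (ℰ' , D') =
    ℰ' ⊆ ℰ ×
    Σ (Fin (m Γ) → Fin (n Γ)) λ φ →
      (∀ e → e ∈ ℰ → e ∉ ℰ' → (φ e ≡ src Γ e) ⊎ (φ e ≡ tgt Γ e)) ×
      (∀ v → lookup D' v ≡ lookup D v
                + ∑ (λ e → [ lookup ℰ e ∧ not (lookup ℰ' e) ∧ (φ e == v) ]))

  rankPD : PseudoDiv → ℕ
  rankPD (ℰ , D) = ∣ ℰ ∣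

  Ends : Fin (m Γ) → Fin (n Γ) → Fin (n Γ) → Set
  Ends e s t = (src Γ e ≡ s × tgt Γ e ≡ t) ⊎ (src Γ e ≡ t × tgt Γ e ≡ s)

  Incident : Fin (n Γ) → Fin (m Γ) → Set
  Incident v e = (src Γ e ≡ v) ⊎ (tgt Γ e ≡ v)

  Parallel : Fin (m Γ) → Fin (m Γ) → Set
  Parallel e₁ e₂ = ∃ λ u → ∃ λ v → u ≢ v ×
    Incident u e₁ × Incident u e₂ × Incident v e₁ × Incident v e₂

  -- D + v_e  and  D + s
  withEdge : Vec ℤ (n Γ) → Fin (m Γ) → PseudoDiv
  withEdge D e = (⁅ e ⁆ , D)

  withVertex : Vec ℤ (n Γ) → Fin (n Γ) → PseudoDiv
  withVertex D s = (Sub.⊥ , D [ s ]%= (λ z → z + + 1))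

data P : Set where
  α β γ δ : P

data _≤P_ : P → P → Set where
  refl≤ : ∀ {x} → x ≤P x
  γ≤α : γ ≤P α
  γ≤β : γ ≤P β
  δ≤α : δ ≤P α
  δ≤β : δ ≤P β

rankP : P → ℕ
rankP α = 1
rankP β = 1
rankP γ = 0
rankP δ = 0

record InjMorphism (Γ : Graph) (v₀ : Fin (n Γ)) : Set where
  field
    g          : P → PseudoDiv Γ
    g-qs       : ∀ x → QuasiStable Γ v₀ (g x)
    g-mono     : ∀ {x y} → x ≤P y → _≥PD_ Γ (g y) (g x)
    g-rank     : ∀ x → rankPD Γ (g x) ≡ rankP x
    g-inj      : ∀ {x y} → g x ≡ g y → x ≡ y

{-# OPTIONS --safe #-}
-- The rank-1 images are (⁅ e₁ ⁆ , A) and (⁅ e₂ ⁆ , B), and a specialization of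
-- (⁅ e ⁆ , A) to rank 0 moves the chip on v_e to an end-vertex of e. So
-- g γ = A + s = B + a and g δ = A + t = B + b, with s ≠ t by injectivity.
-- Comparing the two sides pointwise (a unit step is detected by the single
-- coordinate where it adds 1) forces a = s, b = t and A = B, so s and t are
-- the ends of both e₁ and e₂.
module Submission where

open import Defs
open import Data.Fin using (Fin)
open import Data.Vec using (Vec)
open import Data.Integer using (ℤ)
open import Data.Product using (∃; _×_)
open import Data.Sum using (_⊎_)
open import Relation.Binary.PropositionalEquality using (_≡_; _≢_)

open import Algebra.Bundles using (AbelianGroup)
open import Data.Bool using (Bool; true; false; _∧_; not)
open import Data.Empty using (⊥-elim)
open import Data.Fin using (zero; suc; _≟_)
open import Data.Fin.Subset using (Subset; ⁅_⁆; ∣_∣)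
import Data.Fin.Subset as Subset
open import Data.Fin.Subset.Properties using (x∈⁅x⁆; ∉⊥)
open import Data.Integer using (+_; _+_)
open import Data.Integer.Properties using (+-0-abelianGroup; +-identityˡ; +-identityʳ; +-assoc)
import Data.Nat as ℕ
import Data.Nat.Properties as ℕ
open import Data.Product using (∃₂; _,_; proj₁; proj₂)
open import Data.Sum using (inj₁; inj₂)
open import Data.Vec using ([]; _∷_; lookup; _[_]%=_)
open import Data.Vec.Properties using (lookup∘updateAt; lookup∘updateAt′; lookup-replicate; tabulate∘lookup; tabulate-cong)
open import Relation.Nullary using (yes; no)
open import Relation.Nullary.Decidable using (⌊_⌋)
open import Relation.Binary.PropositionalEquality using (refl; sym; trans; cong; subst; subst₂; module ≡-Reasoning)

open import Algebra.Properties.Group (AbelianGroup.group +-0-abelianGroup)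
  using (∙-cancelˡ; ∙-cancelʳ)

≗⇒≡ : ∀ {A : Set} {k} {xs ys : Vec A k} → (∀ i → lookup xs i ≡ lookup ys i) → xs ≡ ys
≗⇒≡ {xs = xs} {ys} h = trans (sym (tabulate∘lookup xs)) (trans (tabulate-cong h) (tabulate∘lookup ys))

∣p∣≡0⇒p≡⊥ : ∀ {k} (p : Subset k) → ∣ p ∣ ≡ 0 → p ≡ Subset.⊥
∣p∣≡0⇒p≡⊥ []          _ = refl
∣p∣≡0⇒p≡⊥ (true ∷ p)  ()
∣p∣≡0⇒p≡⊥ (false ∷ p) h = cong (false ∷_) (∣p∣≡0⇒p≡⊥ p h)

∣p∣≡1⇒p≡⁅x⁆ : ∀ {k} (p : Subset k) → ∣ p ∣ ≡ 1 → ∃ λ x → p ≡ ⁅ x ⁆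
∣p∣≡1⇒p≡⁅x⁆ []          ()
∣p∣≡1⇒p≡⁅x⁆ (true ∷ p)  h = zero , cong (true ∷_) (∣p∣≡0⇒p≡⊥ p (ℕ.suc-injective h))
∣p∣≡1⇒p≡⁅x⁆ (false ∷ p) h with ∣p∣≡1⇒p≡⁅x⁆ p h
... | x , p≡⁅x⁆ = suc x , cong (false ∷_) p≡⁅x⁆

∑-⊥∧ : ∀ {k} (f : Fin k → Bool) → ∑ (λ i → [ lookup (Subset.⊥ {k}) i ∧ f i ]) ≡ + 0
∑-⊥∧ {ℕ.zero}  f = refl
∑-⊥∧ {ℕ.suc k} f = trans (+-identityˡ _) (∑-⊥∧ {k} (λ i → f (suc i)))

∑-⁅x⁆∧ : ∀ {k} (x : Fin k) (f : Fin k → Bool) → ∑ (λ i → [ lookup ⁅ x ⁆ i ∧ f i ]) ≡ [ f x ]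
∑-⁅x⁆∧ zero    f = trans (cong (_+_ [ f zero ]) (∑-⊥∧ (λ i → f (suc i)))) (+-identityʳ _)
∑-⁅x⁆∧ (suc x) f = trans (+-identityˡ _) (∑-⁅x⁆∧ x (λ i → f (suc i)))

𝟙 : ∀ {k} → Fin k → Fin k → ℤ
𝟙 s v = [ ⌊ s ≟ v ⌋ ]

𝟙-refl : ∀ {k} (s : Fin k) → 𝟙 s s ≡ + 1
𝟙-refl s with s ≟ s
... | yes _  = refl
... | no s≢s = ⊥-elim (s≢s refl)

𝟙-≢ : ∀ {k} {s v : Fin k} → s ≢ v → 𝟙 s v ≡ + 0
𝟙-≢ {s = s} {v} s≢v with s ≟ v
... | yes s≡v = ⊥-elim (s≢v s≡v)
... | no _    = refl

𝟙≡1⇒≡ : ∀ {k} {s v : Fin k} → 𝟙 s v ≡ + 1 → s ≡ v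
𝟙≡1⇒≡ {s = s} {v} h with s ≟ v
𝟙≡1⇒≡ h | yes s≡v = s≡v
𝟙≡1⇒≡ () | no _

_[_]+1 : ∀ {k} → Vec ℤ k → Fin k → Vec ℤ k
D [ s ]+1 = D [ s ]%= (_+ + 1)

lookup-+1 : ∀ {k} (D : Vec ℤ k) (s v : Fin k) → lookup (D [ s ]+1) v ≡ lookup D v + 𝟙 s v
lookup-+1 D s v with s ≟ v
... | yes refl = lookup∘updateAt s D
... | no s≢v   = trans (lookup∘updateAt′ v s (λ v≡s → s≢v (sym v≡s)) D) (sym (+-identityʳ _))

+1-pointwise : ∀ {k} {D E : Vec ℤ k} {s a : Fin k} → D [ s ]+1 ≡ E [ a ]+1 →
               ∀ v → lookup D v + 𝟙 s v ≡ lookup E v + 𝟙 a v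
+1-pointwise {D = D} {E} {s} {a} h v =
  trans (sym (lookup-+1 D s v)) (trans (cong (λ X → lookup X v) h) (lookup-+1 E a v))

+1-injectiveˡ : ∀ {k} {D E : Vec ℤ k} {s : Fin k} → D [ s ]+1 ≡ E [ s ]+1 → D ≡ E
+1-injectiveˡ {D = D} {E} {s} h = ≗⇒≡ (λ v → ∙-cancelʳ (𝟙 s v) _ _ (+1-pointwise h v))

+1-injectiveʳ : ∀ {k} {D : Vec ℤ k} {s t : Fin k} → D [ s ]+1 ≡ D [ t ]+1 → s ≡ t
+1-injectiveʳ {D = D} {s} {t} h = sym (𝟙≡1⇒≡ (begin
  𝟙 t s  ≡⟨ sym (∙-cancelˡ (lookup D s) _ _ (+1-pointwise h s)) ⟩
  𝟙 s s  ≡⟨ 𝟙-refl s ⟩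
  + 1    ∎))
  where open ≡-Reasoning

x≡y+1⇒x+[c]≢y+0 : ∀ x y (c : Bool) → x ≡ y + + 1 → x + [ c ] ≢ y + + 0
x≡y+1⇒x+[c]≢y+0 x y c x≡y+1 x+c≡y with ∙-cancelˡ y (+ 1 + [ c ]) (+ 0) (begin
  y + (+ 1 + [ c ])  ≡⟨ sym (+-assoc y (+ 1) [ c ]) ⟩
  y + + 1 + [ c ]    ≡⟨ cong (_+ [ c ]) (sym x≡y+1) ⟩
  x + [ c ]          ≡⟨ x+c≡y ⟩
  y + + 0            ∎)
  where open ≡-Reasoning
x≡y+1⇒x+[c]≢y+0 x y true  _ _ | ()
x≡y+1⇒x+[c]≢y+0 x y false _ _ | ()

+1-diamond : ∀ {k} {D E : Vec ℤ k} {s t a b : Fin k} → s ≢ t →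
             D [ s ]+1 ≡ E [ a ]+1 → D [ t ]+1 ≡ E [ b ]+1 →
             a ≡ s × b ≡ t × D ≡ E
+1-diamond {D = D} {E} {s} {t} {a} {b} s≢t hs ht = a≡s , b≡t , D≡E
  where
  a≢b : a ≢ b
  a≢b a≡b = s≢t (+1-injectiveʳ (trans hs (trans (cong (E [_]+1) a≡b) (sym ht))))

  a≡s : a ≡ s
  a≡s with a ≟ s
  ... | yes a≡s = a≡s
  ... | no a≢s  = ⊥-elim (x≡y+1⇒x+[c]≢y+0 (lookup D a) (lookup E a) ⌊ t ≟ a ⌋ Da≡Ea+1 Da+𝟙≡Ea)
    where
    Da≡Ea+1 : lookup D a ≡ lookup E a + + 1
    Da≡Ea+1 = begin
      lookup D a               ≡⟨ sym (+-identityʳ _) ⟩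
      lookup D a + + 0         ≡⟨ cong (_+_ (lookup D a)) (sym (𝟙-≢ (λ s≡a → a≢s (sym s≡a)))) ⟩
      lookup D a + 𝟙 s a       ≡⟨ +1-pointwise hs a ⟩
      lookup E a + 𝟙 a a       ≡⟨ cong (_+_ (lookup E a)) (𝟙-refl a) ⟩
      lookup E a + + 1         ∎
      where open ≡-Reasoning
    Da+𝟙≡Ea : lookup D a + 𝟙 t a ≡ lookup E a + + 0
    Da+𝟙≡Ea = trans (+1-pointwise ht a) (cong (_+_ (lookup E a)) (𝟙-≢ (λ b≡a → a≢b (sym b≡a))))

  D≡E : D ≡ E
  D≡E = +1-injectiveˡ (trans hs (cong (E [_]+1) a≡s))

  b≡t : b ≡ t
  b≡t = sym (+1-injectiveʳ (trans ht (cong (_[ b ]+1) (sym D≡E))))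

incident-≢⇒Ends : (Γ : Graph) {e : Fin (m Γ)} {s t : Fin (n Γ)} →
                  Incident Γ s e → Incident Γ t e → s ≢ t → Ends Γ e s t
incident-≢⇒Ends Γ (inj₁ p) (inj₁ q) s≢t = ⊥-elim (s≢t (trans (sym p) q))
incident-≢⇒Ends Γ (inj₁ p) (inj₂ q) s≢t = inj₁ (p , q)
incident-≢⇒Ends Γ (inj₂ p) (inj₁ q) s≢t = inj₂ (q , p)
incident-≢⇒Ends Γ (inj₂ p) (inj₂ q) s≢t = ⊥-elim (s≢t (trans (sym p) q))

withEdge≥⇒withVertex : (Γ : Graph) {e : Fin (m Γ)} {A C : Vec ℤ (n Γ)} →
  _≥PD_ Γ (withEdge Γ A e) (Subset.⊥ , C) →
  ∃ λ s → Incident Γ s e × C ≡ A [ s ]+1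
withEdge≥⇒withVertex Γ {e} {A} {C} (_ , φ , φ-end , C≡A+φ) =
  φ e , incident (φ-end e (x∈⁅x⁆ e) ∉⊥) , ≗⇒≡ C≗A+φe
  where
  incident : (φ e ≡ src Γ e) ⊎ (φ e ≡ tgt Γ e) → Incident Γ (φ e) e
  incident (inj₁ p) = inj₁ (sym p)
  incident (inj₂ p) = inj₂ (sym p)

  C≗A+φe : ∀ v → lookup C v ≡ lookup (A [ φ e ]+1) v
  C≗A+φe v = begin
    lookup C v
      ≡⟨ C≡A+φ v ⟩
    lookup A v + ∑ (λ i → [ lookup ⁅ e ⁆ i ∧ not (lookup Subset.⊥ i) ∧ ⌊ φ i ≟ v ⌋ ])
      ≡⟨ cong (_+_ (lookup A v)) (∑-⁅x⁆∧ e _) ⟩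
    lookup A v + [ not (lookup Subset.⊥ e) ∧ ⌊ φ e ≟ v ⌋ ]
      ≡⟨ cong (λ b → lookup A v + [ not b ∧ ⌊ φ e ≟ v ⌋ ]) (lookup-replicate e false) ⟩
    lookup A v + 𝟙 (φ e) v
      ≡⟨ sym (lookup-+1 A (φ e) v) ⟩
    lookup (A [ φ e ]+1) v
      ∎
    where open ≡-Reasoning

module _ {Γ : Graph} {v₀ : Fin (n Γ)} (G : InjMorphism Γ v₀) where
  open InjMorphism G

  rank1-image : ∀ x → rankP x ≡ 1 → ∃₂ λ e A → g x ≡ withEdge Γ A e
  rank1-image x r with ∣p∣≡1⇒p≡⁅x⁆ (proj₁ (g x)) (trans (g-rank x) r)
  ... | e , ℰ≡⁅e⁆ = e , proj₂ (g x) , cong (_, proj₂ (g x)) ℰ≡⁅e⁆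

  rank0-image : ∀ y → rankP y ≡ 0 → g y ≡ (Subset.⊥ , proj₂ (g y))
  rank0-image y r = cong (_, proj₂ (g y)) (∣p∣≡0⇒p≡⊥ (proj₁ (g y)) (trans (g-rank y) r))

  below-edge : ∀ {x y e A} → y ≤P x → rankP y ≡ 0 → g x ≡ withEdge Γ A e →
               ∃ λ s → Incident Γ s e × g y ≡ withVertex Γ A s
  below-edge {x} {y} y≤x r gx≡ with withEdge≥⇒withVertex Γ (subst₂ (_≥PD_ Γ) gx≡ (rank0-image y r) (g-mono y≤x))
  ... | s , s∈e , C≡A+s = s , s∈e , trans (rank0-image y r) (cong (Subset.⊥ ,_) C≡A+s)

  edges-distinct : ∀ {x y D e e′} → x ≢ y → g x ≡ withEdge Γ D e → g y ≡ withEdge Γ D e′ → e ≢ e′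
  edges-distinct x≢y gx gy e≡e′ = x≢y (g-inj (trans gx (trans (cong (withEdge Γ _) e≡e′) (sym gy))))

  vertices-distinct : ∀ {x y D s t} → x ≢ y → g x ≡ withVertex Γ D s → g y ≡ withVertex Γ D t → s ≢ t
  vertices-distinct x≢y gx gy s≡t = x≢y (g-inj (trans gx (trans (cong (withVertex Γ _) s≡t) (sym gy))))

corollary4p3 : (Γ : Graph) (v₀ : Fin (n Γ)) (G : InjMorphism Γ v₀) →
    let g = InjMorphism.g G in
    ∃ λ (e₁ : Fin (m Γ)) → ∃ λ (e₂ : Fin (m Γ)) →
    ∃ λ (s : Fin (n Γ)) → ∃ λ (t : Fin (n Γ)) → ∃ λ (D : Vec ℤ (n Γ)) →
      e₁ ≢ e₂ × Parallel Γ e₁ e₂ × Ends Γ e₁ s t × Ends Γ e₂ s t ×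
      (∀ x → (g x ≡ withEdge Γ D e₁) ⊎ (g x ≡ withEdge Γ D e₂)
               ⊎ (g x ≡ withVertex Γ D s) ⊎ (g x ≡ withVertex Γ D t)) ×
      (∃ λ x → g x ≡ withEdge Γ D e₁) × (∃ λ x → g x ≡ withEdge Γ D e₂) ×
      (∃ λ x → g x ≡ withVertex Γ D s) × (∃ λ x → g x ≡ withVertex Γ D t)
corollary4p3 Γ v₀ G =
  let (e₁ , A , gα) = rank1-image G α refl
      (e₂ , B , gβ) = rank1-image G β refl
      (s , s∈e₁ , gγ) = below-edge G γ≤α refl gα
      (t , t∈e₁ , gδ) = below-edge G δ≤α refl gα
      (a , a∈e₂ , gγ′) = below-edge G γ≤β refl gβ
      (b , b∈e₂ , gδ′) = below-edge G δ≤β refl gβ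
      s≢t = vertices-distinct G (λ ()) gγ gδ
      (a≡s , b≡t , A≡B) = +1-diamond s≢t (cong proj₂ (trans (sym gγ) gγ′)) (cong proj₂ (trans (sym gδ) gδ′))
      gβ′ = trans gβ (cong (λ X → withEdge Γ X e₂) (sym A≡B))
      s∈e₂ = subst (λ z → Incident Γ z e₂) a≡s a∈e₂
      t∈e₂ = subst (λ z → Incident Γ z e₂) b≡t b∈e₂
  in e₁ , e₂ , s , t , A , edges-distinct G (λ ()) gα gβ′ , (s , t , s≢t , s∈e₁ , s∈e₂ , t∈e₁ , t∈e₂) ,
     incident-≢⇒Ends Γ s∈e₁ t∈e₁ s≢t , incident-≢⇒Ends Γ s∈e₂ t∈e₂ s≢t ,
     (λ { α → inj₁ gα ; β → inj₂ (inj₁ gβ′) ; γ → inj₂ (inj₂ (inj₁ gγ)) ; δ → inj₂ (inj₂ (inj₂ gδ)) }) ,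
     (α , gα) , (β , gβ′) , (γ , gγ) , (δ , gδ)
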